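{- Let $\lambda=(\lambda_n)_{1\leq n\leq d}$ be an extractor, let $\vec{X}\subseteq\mathbb{N}_I^d$, and let $L\subseteq\{1,\ldots,d\}$ be a set of indexes included in the minimal excluding set of $(\lambda,\vec{X})$. Then $\lambda(\vec{X})=\lambda(\pi_L(\vec{X}))$.
   Context: Let $\star$ be a new symbol, $\mathbb{N}_\star=\mathbb{N}\cup\{\star\}$, ordered by the usual order on $\mathbb{N}$ together with $z\leq\star$ for all $z$. For $I\subseteq\{1,\ldots,d\}$, $\mathbb{N}_I^d$ is the set of $\vec{c}\in\mathbb{N}_\star^d$ with $\{i\mid\vec{c}(i)=\star\}=I$. For $L\subseteq\{1,\ldots,d\}$ and $\vec{x}\in\mathbb{N}_I^d$, $\pi_L(\vec{x})\in\mathbb{N}_{I\cup L}^d$ equals $\vec{x}(i)$ for $i\notin L$ and $\star$ for $i\in L$; $\pi_L(\vec{X})=\{\pi_L(\vec{x})\mid\vec{x}\in\vec{X}\}$. An extractor is a non-increasing sequence $\lambda=(\lambda_n)_{1\leq n\leq d}$ of natural numbers. For $\vec{X}\subseteq\mathbb{N}_I^d$, a set $J\subseteq\{1,\ldots,d\}$ is excluding for $(\lambda,\vec{X})$ if $\vec{x}(i)<\lambda_{|J|+1}$ for every $i\notin J$ and every $\vec{x}\in\vec{X}$ (vacuous when $|J|=d$). Excluding sets are closed under intersection and $\{1,\ldots,d\}$ is excluding, so there is a unique minimal excluding set $J$, and $\lambda(\vec{X})$ is defined as $\pi_J(\vec{X})$. -}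

module Defs where

open import Data.Nat using (ℕ; _<_; _≤_)
open import Data.Fin using (Fin; fromℕ<) renaming (_≤_ to _≤ᶠ_)
open import Data.Fin.Subset using (Subset; _∈_; _∉_; _⊆_; ∣_∣)
open import Data.Maybe using (Maybe; just; nothing)
open import Data.Bool using (if_then_else_)
open import Data.Vec using (Vec; lookup; zipWith)
open import Data.Product using (∃; _×_)
open import Data.Empty using (⊥)
open import Relation.Binary.PropositionalEquality using (_≡_)
open import Function using (_⇔_)

ℕ⋆ : Set
ℕ⋆ = Maybe ℕ

⋆ : ℕ⋆
⋆ = nothing

-- strict comparison of an element of ℕ⋆ with a natural number (⋆ is the maximum)
_<⋆_ : ℕ⋆ → ℕ → Set
just n <⋆ m = n < m
nothing <⋆ m = ⊥

-- vectors of ℕ⋆^d; index i : Fin d corresponds to coordinate i+1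
Vec⋆ : ℕ → Set
Vec⋆ d = Vec ℕ⋆ d

VSet : ℕ → Set₁
VSet d = Vec⋆ d → Set

-- x ∈ ℕ_I^d : the set of ⋆-coordinates of x is exactly I
InNI : ∀ {d} → Subset d → Vec⋆ d → Set
InNI {d} I x = (i : Fin d) → (lookup x i ≡ ⋆ → i ∈ I) × (i ∈ I → lookup x i ≡ ⋆)

_⊆NI_ : ∀ {d} → VSet d → Subset d → Set
_⊆NI_ {d} X I = (x : Vec⋆ d) → X x → InNI I x

π : ∀ {d} → Subset d → Vec⋆ d → Vec⋆ d
π L x = zipWith (λ b c → if b then ⋆ else c) L x

πSet : ∀ {d} → Subset d → VSet d → VSet d
πSet L X y = ∃ λ x → X x × y ≡ π L x

-- extractor λ = (λ_1, ..., λ_d), λ_{n+1} = ext (n : Fin d); non-increasing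
IsExtractor : ∀ {d} → (Fin d → ℕ) → Set
IsExtractor {d} ext = (i j : Fin d) → i ≤ᶠ j → ext j ≤ ext i

-- J excluding for (λ, X): x(i) < λ_{|J|+1} for all i ∉ J, x ∈ X (vacuous when |J| = d)
Excluding : ∀ {d} → (Fin d → ℕ) → VSet d → Subset d → Set
Excluding {d} ext X J =
  (h : ∣ J ∣ < d) → (x : Vec⋆ d) → X x → (i : Fin d) → i ∉ J →
  lookup x i <⋆ ext (fromℕ< h)

IsMinExcluding : ∀ {d} → (Fin d → ℕ) → VSet d → Subset d → Set
IsMinExcluding {d} ext X J =
  Excluding ext X J × ((K : Subset d) → Excluding ext X K → J ⊆ K)

_≐_ : ∀ {d} → VSet d → VSet d → Set
_≐_ {d} X Y = (y : Vec⋆ d) → X y ⇔ Y y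

-- π_L leaves the coordinates outside L untouched and writes ⋆ on L, and ⋆ lies below no
-- bound. Hence every excluding set of π_L(X) contains L and is excluding for X, while an
-- excluding set of X containing L is excluding for π_L(X). So J is also the minimal
-- excluding set of π_L(X), i.e. J′ = J, and π_J absorbs π_L since L ⊆ J.
module Submission where

open import Defs
open import Data.Nat using (ℕ)
open import Data.Fin using (Fin; zero; suc)
open import Data.Fin.Subset using (Subset; _⊆_; _∈_; _∉_; inside; outside)
open import Data.Fin.Subset.Properties using (_∈?_; ⊆-antisym; drop-∷-⊆)
open import Data.Vec using (_∷_; []; lookup)
open import Data.Vec.Base using (here; there)
open import Data.Product using (_,_)
open import Data.Empty using (⊥-elim)
open import Relation.Nullary using (yes; no)
open import Relation.Binary.PropositionalEquality using (_≡_; refl; cong; sym; subst)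
open import Function using (mk⇔)

lookup-π-∉ : ∀ {d} (L : Subset d) (x : Vec⋆ d) {i : Fin d} →
             i ∉ L → lookup (π L x) i ≡ lookup x i
lookup-π-∉ (outside ∷ L) (a ∷ x) {zero}  i∉L = refl
lookup-π-∉ (inside  ∷ L) (a ∷ x) {zero}  i∉L = ⊥-elim (i∉L here)
lookup-π-∉ (b       ∷ L) (a ∷ x) {suc i} i∉L = lookup-π-∉ L x (λ i∈L → i∉L (there i∈L))

lookup-π-∈ : ∀ {d} (L : Subset d) (x : Vec⋆ d) {i : Fin d} →
             i ∈ L → lookup (π L x) i ≡ ⋆
lookup-π-∈ (b ∷ L) (a ∷ x) here         = refl
lookup-π-∈ (b ∷ L) (a ∷ x) (there i∈L) = lookup-π-∈ L x i∈L

π-absorb : ∀ {d} {L J : Subset d} → L ⊆ J → (x : Vec⋆ d) → π J (π L x) ≡ π J x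
π-absorb {L = []}          {[]}          L⊆J []      = refl
π-absorb {L = b       ∷ L} {inside  ∷ J} L⊆J (a ∷ x) = cong (⋆ ∷_) (π-absorb (drop-∷-⊆ L⊆J) x)
π-absorb {L = outside ∷ L} {outside ∷ J} L⊆J (a ∷ x) = cong (a ∷_) (π-absorb (drop-∷-⊆ L⊆J) x)
π-absorb {L = inside  ∷ L} {outside ∷ J} L⊆J (a ∷ x) with L⊆J here
... | ()

πSet-absorb : ∀ {d} {L J : Subset d} → L ⊆ J → (X : VSet d) → πSet J X ≐ πSet J (πSet L X)
πSet-absorb {L = L} L⊆J X y = mk⇔ to from
  where
  to : πSet _ X y → πSet _ (πSet L X) y
  to (x , Xx , refl) = π L x , (x , Xx , refl) , sym (π-absorb L⊆J x)
  from : πSet _ (πSet L X) y → πSet _ X y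
  from (_ , (x , Xx , refl) , refl) = x , Xx , π-absorb L⊆J x

module _ {d} (ext : Fin d → ℕ) (X : VSet d) where

  Excluding-π : ∀ {L K : Subset d} → L ⊆ K → Excluding ext X K → Excluding ext (πSet L X) K
  Excluding-π {L} L⊆K exK h _ (x , Xx , refl) i i∉K =
    subst (_<⋆ _) (sym (lookup-π-∉ L x (λ i∈L → i∉K (L⊆K i∈L)))) (exK h x Xx i i∉K)

  Excluding-π⁻ : ∀ {L K : Subset d} → Excluding ext (πSet L X) K → Excluding ext X K
  Excluding-π⁻ {L} exK h x Xx i i∉K with i ∈? L | exK h (π L x) (x , Xx , refl) i i∉K
  ... | yes i∈L | bound = ⊥-elim (subst (_<⋆ _) (lookup-π-∈ L x i∈L) bound)
  ... | no  i∉L | bound = subst (_<⋆ _) (lookup-π-∉ L x i∉L) bound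

  IsMinExcluding-π : ∀ {L J : Subset d} → L ⊆ J →
                     IsMinExcluding ext X J → IsMinExcluding ext (πSet L X) J
  IsMinExcluding-π L⊆J (exJ , minJ) = Excluding-π L⊆J exJ , λ K exK → minJ K (Excluding-π⁻ exK)

  IsMinExcluding-unique : ∀ {J J′ : Subset d} →
                          IsMinExcluding ext X J → IsMinExcluding ext X J′ → J ≡ J′
  IsMinExcluding-unique (exJ , minJ) (exJ′ , minJ′) = ⊆-antisym (minJ _ exJ′) (minJ′ _ exJ)

lemma8p2 : (d : ℕ) (ext : Fin d → ℕ) → IsExtractor ext →
    (I : Subset d) (X : VSet d) → X ⊆NI I →
    (L J : Subset d) → IsMinExcluding ext X J → L ⊆ J →
    (J′ : Subset d) → IsMinExcluding ext (πSet L X) J′ →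
    πSet J X ≐ πSet J′ (πSet L X)
lemma8p2 d ext _ I X _ L J minJ L⊆J J′ minJ′
  with IsMinExcluding-unique ext (πSet L X) (IsMinExcluding-π ext X L⊆J minJ) minJ′
... | refl = πSet-absorb L⊆J X
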